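{- Let $i\in\mathbb{Z}$, $a\in\mathbb{A}_i$ and $x\in\mathsf{Set}_i$. (1) If $Z\in\mathsf{Pred}$ then $Z[a\mapsto x]$ is well-defined, $\mathrm{minlev}(Z[a\mapsto x])\geq\mathrm{minlev}(Z,a,x)$, and $Z[a\mapsto x]\in\mathsf{Pred}$. (2) If $k\in\mathbb{Z}$ and $z\in\mathsf{Set}_k$ then $z[a\mapsto x]$ is well-defined, $\mathrm{minlev}(z[a\mapsto x])\geq\mathrm{minlev}(z,a,x)$, and $z[a\mapsto x]\in\mathsf{Set}_k$.
   Context: Atoms: for each $i\in\mathbb{Z}$ fix a countably infinite set $\mathbb{A}_i$ of atoms, pairwise disjoint, $\mathbb{A}=\bigcup_i\mathbb{A}_i$, $\mathrm{level}(a)=i$ iff $a\in\mathbb{A}_i$. Permutations are finitely-supported level-preserving bijections of $\mathbb{A}$; $(a\ b)$ is the swapping; $\mathrm{supp}(x)$ is the least finite set of atoms such that every permutation fixing it pointwise fixes $x$, and $a\#x$ means $a\notin\mathrm{supp}(x)$. $[a]X$ is nominal atoms-abstraction (binding $a$ in $X$): $[a]X=[b]((b\ a)\cdot X)$ when $b\#X$. Internal syntax: $\mathsf{Pred}$ and $\mathsf{Set}_i$ ($i\in\mathbb{Z}$) are defined inductively: $\mathsf{atm}(a)\in\mathsf{Set}_i$ for $a\in\mathbb{A}_i$; $\mathsf{and}(\mathcal X)\in\mathsf{Pred}$ for finite $\mathcal X\subseteq\mathsf{Pred}$; $\mathsf{neg}(X)$; $\mathsf{all}([a]X)$ for $a\in\mathbb{A}$;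 $\mathsf{elt}(x,a)\in\mathsf{Pred}$ for $a\in\mathbb{A}_{i+1}$, $x\in\mathsf{Set}_i$; $\mathsf{st}([a]X)\in\mathsf{Set}_i$ for $a\in\mathbb{A}_{i-1}$, $X\in\mathsf{Pred}$ (an internal comprehension). Sigma-action: for $a\in\mathbb{A}_i$, $x\in\mathsf{Set}_i$, $Z[a\mapsto x]$ and $z[a\mapsto x]$ are specified by the clauses (with $b,c$ atoms distinct from $a$): $\mathsf{and}(\mathcal X)[a\mapsto x]=\mathsf{and}(\{X[a\mapsto x]\mid X\in\mathcal X\})$; $\mathsf{neg}(X)[a\mapsto x]=\mathsf{neg}(X[a\mapsto x])$; $\mathsf{all}([b]X)[a\mapsto x]=\mathsf{all}([b](X[a\mapsto x]))$ if $b\#x$; $\mathsf{elt}(y,a)[a\mapsto\mathsf{atm}(n)]=\mathsf{elt}(y[a\mapsto\mathsf{atm}(n)],n)$ for any $n\in\mathbb{A}_i$; $\mathsf{elt}(y,a)[a\mapsto\mathsf{st}([a']X')]=X'[a'\mapsto y[a\mapsto\mathsf{st}([a']X')]]$ for a fresh $a'\in\mathbb{A}_{i-1}$; $\mathsf{elt}(y,b)[a\mapsto x]=\mathsf{elt}(y[a\mapsto x],b)$; $\mathsf{atm}(a)[a\mapsto x]=x$; $\mathsf{atm}(b)[a\mapsto x]=\mathsf{atm}(b)$; $\mathsf{st}([c]X)[a\mapsto x]=\mathsf{st}([c](X[a\mapsto x]))$ if $c\#x$. Minimum level: $\mathrm{minlev}(\mathsf{atm}(a))=\mathrm{level}(a)$;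 $\mathrm{minlev}(\mathsf{and}(\mathcal X))=\min(\{0\}\cup\{\mathrm{minlev}(X)\mid X\in\mathcal X\})$; $\mathrm{minlev}(\mathsf{neg}(X))=\mathrm{minlev}(X)$; $\mathrm{minlev}(\mathsf{all}([a]X))=\min(\mathrm{level}(a),\mathrm{minlev}(X))$; $\mathrm{minlev}(\mathsf{elt}(x,a))=\min(\mathrm{minlev}(x),\mathrm{level}(a))$; $\mathrm{minlev}(\mathsf{st}([a]X))=\min(\mathrm{level}(a),\mathrm{minlev}(X))$; $\mathrm{minlev}(a)=\mathrm{level}(a)$ for an atom $a$; for a list, $\mathrm{minlev}(l_1,\dots,l_n)$ is the least of the $\mathrm{minlev}(l_j)$. -}

module Defs where

open import Data.Nat using (ℕ)
import Data.Nat as ℕ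
open import Data.Integer using (ℤ; _+_; _-_; _⊓_; _≤_; 0ℤ; 1ℤ)
import Data.Integer as ℤ
open import Data.Product using (_×_; _,_; proj₁; proj₂)
open import Data.Product.Properties using (≡-dec)
open import Data.List using (List; []; _∷_)
open import Data.List.Relation.Unary.All using (All)
open import Data.List.Relation.Unary.Any using (Any)
open import Data.List.Relation.Binary.Pointwise using (Pointwise)
open import Relation.Binary.PropositionalEquality using (_≡_; _≢_)
open import Relation.Nullary using (¬_; yes; no)
open import Relation.Binary.Definitions using (DecidableEquality)

-- Atoms.  An atom is a pair (level , name); 𝔸ᵢ = {i} × ℕ is countably
-- infinite, and the 𝔸ᵢ are pairwise disjoint.

Atom : Set
Atom = ℤ × ℕ

level : Atom → ℤ
level = proj₁

_≟ₐ_ : DecidableEquality Atom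
_≟ₐ_ = ≡-dec ℤ._≟_ ℕ._≟_

-- the swapping (a b) acting on atoms (used only for a, b of equal level,
-- so it is level preserving)
swapAtom : Atom → Atom → Atom → Atom
swapAtom a b c with c ≟ₐ a
... | yes _ = b
... | no _ with c ≟ₐ b
...   | yes _ = a
...   | no _ = c

-- The nominal syntax of the paper
-- is this raw syntax modulo α-equivalence _≈α_ below; finite sets 𝒳 of
-- predicates are represented by lists, considered up to set equality.

data Term : Set where
  atm : Atom → Term
  and : List Term → Term
  neg : Term → Term
  all : Atom → Term → Term
  elt : Term → Atom → Term
  st  : Atom → Term → Term

-- free atoms (the support of the α-class)
data _∈fa_ (b : Atom) : Term → Set where
  fa-atm  : b ∈fa atm b
  fa-and  : ∀ {Xs} → Any (b ∈fa_) Xs → b ∈fa and Xs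
  fa-neg  : ∀ {X} → b ∈fa X → b ∈fa neg X
  fa-all  : ∀ {a X} → b ≢ a → b ∈fa X → b ∈fa all a X
  fa-elt₁ : ∀ {x a} → b ∈fa x → b ∈fa elt x a
  fa-elt₂ : ∀ {x} → b ∈fa elt x b
  fa-st   : ∀ {a X} → b ≢ a → b ∈fa X → b ∈fa st a X

_#_ : Atom → Term → Set
b # X = ¬ (b ∈fa X)

mutual
  swap : Atom → Atom → Term → Term
  swap a b (atm c)   = atm (swapAtom a b c)
  swap a b (and Xs)  = and (swapList a b Xs)
  swap a b (neg X)   = neg (swap a b X)
  swap a b (all c X) = all (swapAtom a b c) (swap a b X)
  swap a b (elt x c) = elt (swap a b x) (swapAtom a b c)
  swap a b (st c X)  = st (swapAtom a b c) (swap a b X)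

  swapList : Atom → Atom → List Term → List Term
  swapList a b []       = []
  swapList a b (X ∷ Xs) = swap a b X ∷ swapList a b Xs

-- α-equivalence (nominal atoms-abstraction: [a]X = [b]Y iff a = b and
-- X = Y, or b # X and (b a)·X = Y), and set-equality for the finite sets
-- under and(-).
data _≈α_ : Term → Term → Set where
  atm≈ : ∀ {a} → atm a ≈α atm a
  and≈ : ∀ {Xs Ys} →
         All (λ X → Any (X ≈α_) Ys) Xs →
         All (λ Y → Any (_≈α Y) Xs) Ys →
         and Xs ≈α and Ys
  neg≈ : ∀ {X Y} → X ≈α Y → neg X ≈α neg Y
  all≈ : ∀ {a X Y} → X ≈α Y → all a X ≈α all a Y
  all≈' : ∀ {a b X Y} → a ≢ b → level a ≡ level b → b # X →
          swap b a X ≈α Y → all a X ≈α all b Y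
  elt≈ : ∀ {x y a} → x ≈α y → elt x a ≈α elt y a
  st≈  : ∀ {a X Y} → X ≈α Y → st a X ≈α st a Y
  st≈' : ∀ {a b X Y} → a ≢ b → level a ≡ level b → b # X →
          swap b a X ≈α Y → st a X ≈α st b Y

mutual
  data IsPred : Term → Set where
    and-P : ∀ {Xs} → All IsPred Xs → IsPred (and Xs)
    neg-P : ∀ {X} → IsPred X → IsPred (neg X)
    all-P : ∀ {a X} → IsPred X → IsPred (all a X)
    elt-P : ∀ {i x a} → level a ≡ i + 1ℤ → IsSet i x → IsPred (elt x a)

  data IsSet : ℤ → Term → Set where
    atm-S : ∀ {i a} → level a ≡ i → IsSet i (atm a)
    st-S  : ∀ {i a X} → level a ≡ i - 1ℤ → IsPred X → IsSet i (st a X)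

-- The sigma-action, as the relation  Subst a x Z R  :⇔  Z[a ↦ x] = R,
-- generated by the defining clauses, on α-classes (closed under ≈α).
-- "Z[a ↦ x] is well-defined" = there is an R with Subst a x Z R, unique
-- up to ≈α.

data Subst (a : Atom) : Term → Term → Term → Set where
  σ-α    : ∀ {x x' Z Z' R R'} → x ≈α x' → Z ≈α Z' → R' ≈α R →
           Subst a x' Z' R' → Subst a x Z R
  σ-and  : ∀ {x Xs Rs} → Pointwise (Subst a x) Xs Rs →
           Subst a x (and Xs) (and Rs)
  σ-neg  : ∀ {x X R} → Subst a x X R → Subst a x (neg X) (neg R)
  σ-all  : ∀ {x b X R} → b ≢ a → b # x → Subst a x X R →
           Subst a x (all b X) (all b R)
  σ-elt-atm : ∀ {y n R} → level n ≡ level a →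
           Subst a (atm n) y R →
           Subst a (atm n) (elt y a) (elt R n)
  σ-elt-st  : ∀ {y a' X' y' R} → level a' ≡ level a - 1ℤ →
           a' # y →
           Subst a (st a' X') y y' →
           Subst a' y' X' R →
           Subst a (st a' X') (elt y a) R
  σ-elt  : ∀ {x y b R} → b ≢ a → Subst a x y R →
           Subst a x (elt y b) (elt R b)
  σ-atm  : ∀ {x} → Subst a x (atm a) x
  σ-atm' : ∀ {x b} → b ≢ a → Subst a x (atm b) (atm b)
  σ-st   : ∀ {x c X R} → c ≢ a → c # x → Subst a x X R →
           Subst a x (st c X) (st c R)

mutual
  minlev : Term → ℤ
  minlev (atm a)   = level a
  minlev (and Xs)  = minlevs Xs
  minlev (neg X)   = minlev X
  minlev (all a X) = level a ⊓ minlev X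
  minlev (elt x a) = minlev x ⊓ level a
  minlev (st a X)  = level a ⊓ minlev X

  minlevs : List Term → ℤ
  minlevs []       = 0ℤ
  minlevs (X ∷ Xs) = minlev X ⊓ minlevs Xs

minlev₃ : Term → Atom → Term → ℤ
minlev₃ Z a x = minlev Z ⊓ (level a ⊓ minlev x)

-- The proof is organised around level-preserving injective renamings of
-- atoms, of which swappings are the special case used in Defs.
--
-- Transitivity is proved
--     in a form generalised over renamings that agree on the free atoms
--     (`≈-trans-ren`), which is what makes the binder cases go through by
--     plain structural induction.
--  3. Uniqueness: Subst is equivariant in the strong sense that if
--     Z[a ↦ x] = R and f(Z)[f(a) ↦ f(x)] = R' (up to α) then f(R) ≈α R'
--     (`subst-equivariant`); uniqueness is the case f = id.
--  4. Existence with the level bound and the sort: by induction on the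
--     typing derivation, for all renamings of Z at once (to rename binders
--     apart), with a fuel bounding level(a) - minlev(Z, a, x); the fuel
--     decreases exactly in the clause elt(y, a)[a ↦ st([a']X')] which
--     substitutes into X' at the lower level of a'.
module Submission where

open import Defs
open import Data.Integer using (ℤ; _≤_)
open import Data.Product using (Σ; _×_)
open import Relation.Binary.PropositionalEquality using (_≡_)

open import Data.Nat using (ℕ; zero; suc; _⊔_)
import Data.Nat as ℕ
import Data.Nat.Properties as ℕP
open import Data.Integer using (_+_; _-_; -_; _⊓_; 1ℤ; +_; _<_; ∣_∣)
import Data.Integer.Properties as ℤP
open import Data.Integer.Tactic.RingSolver using (solve-∀)
open import Data.Product using (_,_; proj₁; proj₂)
open import Data.Sum using (_⊎_; inj₁; inj₂; [_,_])
open import Data.List using (List; []; _∷_)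
open import Data.List.Relation.Unary.All using (All; []; _∷_)
import Data.List.Relation.Unary.All as All
open import Data.List.Relation.Unary.Any using (Any; here; there)
import Data.List.Relation.Unary.Any as Any
open import Data.List.Relation.Binary.Pointwise using (Pointwise; []; _∷_)
open import Data.Empty using (⊥; ⊥-elim)
open import Relation.Nullary using (Dec; yes; no)
open import Relation.Binary.PropositionalEquality
  using (_≢_; refl; sym; trans; cong; cong₂; subst; subst₂; module ≡-Reasoning)
open import Function using (_∘_; id)

data SwapCase (a b c : Atom) : Set where
  is-left  : c ≡ a → SwapCase a b c
  is-right : c ≢ a → c ≡ b → SwapCase a b c
  is-other : c ≢ a → c ≢ b → SwapCase a b c

swapCase : ∀ a b c → SwapCase a b c
swapCase a b c with c ≟ₐ a
... | yes e = is-left e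
... | no n with c ≟ₐ b
...   | yes e = is-right n e
...   | no m = is-other n m

swap-left : ∀ a b → swapAtom a b a ≡ b
swap-left a b with a ≟ₐ a
... | yes _ = refl
... | no n = ⊥-elim (n refl)

swap-right : ∀ a b → swapAtom a b b ≡ a
swap-right a b with b ≟ₐ a
... | yes refl = refl
... | no _ with b ≟ₐ b
...   | yes _ = refl
...   | no n = ⊥-elim (n refl)

swap-other : ∀ a b c → c ≢ a → c ≢ b → swapAtom a b c ≡ c
swap-other a b c p q with c ≟ₐ a
... | yes e = ⊥-elim (p e)
... | no _ with c ≟ₐ b
...   | yes e = ⊥-elim (q e)
...   | no _ = refl

swap-involutive : ∀ a b c → swapAtom a b (swapAtom a b c) ≡ c
swap-involutive a b c with swapCase a b c
... | is-left refl rewrite swap-left a b = swap-right a b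
... | is-right _ refl rewrite swap-right a b = swap-left a b
... | is-other n m rewrite swap-other a b c n m = swap-other a b c n m

swap-comm : ∀ a b c → swapAtom a b c ≡ swapAtom b a c
swap-comm a b c with swapCase a b c
... | is-left refl = trans (swap-left a b) (sym (swap-right b a))
... | is-right _ refl = trans (swap-right a b) (sym (swap-left b a))
... | is-other n m = trans (swap-other a b c n m) (sym (swap-other b a c m n))

swap-injective : ∀ a b {c d} → swapAtom a b c ≡ swapAtom a b d → c ≡ d
swap-injective a b {c} {d} e =
  trans (sym (swap-involutive a b c)) (trans (cong (swapAtom a b) e) (swap-involutive a b d))

swap-level : ∀ a b → level a ≡ level b → ∀ c → level (swapAtom a b c) ≡ level c
swap-level a b lv c with swapCase a b c
... | is-left refl rewrite swap-left a b = sym lv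
... | is-right _ refl rewrite swap-right a b = lv
... | is-other n m rewrite swap-other a b c n m = refl

swap-self : ∀ a c → swapAtom a a c ≡ c
swap-self a c with swapCase a a c
... | is-left refl = swap-left a a
... | is-right n e = ⊥-elim (n e)
... | is-other n m = swap-other a a c n m

record Ren : Set where
  field
    fn  : Atom → Atom
    inj : ∀ {c d} → fn c ≡ fn d → c ≡ d
    lev : ∀ c → level (fn c) ≡ level c
open Ren public

idR : Ren
idR = record { fn = id ; inj = id ; lev = λ _ → refl }

_∘R_ : Ren → Ren → Ren
f ∘R g = record { fn = fn f ∘ fn g ; inj = λ e → inj g (inj f e)
                ; lev = λ c → trans (lev f (fn g c)) (lev g c) }

swapR : (a b : Atom) → level a ≡ level b → Ren
swapR a b lv = record { fn = swapAtom a b ; inj = swap-injective a b ; lev = swap-level a b lv }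

swap-conj : (f : Ren) → ∀ b a c → swapAtom (fn f b) (fn f a) (fn f c) ≡ fn f (swapAtom b a c)
swap-conj f b a c with swapCase b a c
... | is-left refl rewrite swap-left (fn f b) (fn f a) | swap-left b a = refl
... | is-right _ refl rewrite swap-right (fn f b) (fn f a) | swap-right b a = refl
... | is-other n m rewrite swap-other b a c n m =
  swap-other (fn f b) (fn f a) (fn f c) (λ e → n (inj f e)) (λ e → m (inj f e))

mutual
  ren : (Atom → Atom) → Term → Term
  ren f (atm c)   = atm (f c)
  ren f (and Xs)  = and (renL f Xs)
  ren f (neg X)   = neg (ren f X)
  ren f (all c X) = all (f c) (ren f X)
  ren f (elt x c) = elt (ren f x) (f c)
  ren f (st c X)  = st (f c) (ren f X)

  renL : (Atom → Atom) → List Term → List Term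
  renL f []       = []
  renL f (X ∷ Xs) = ren f X ∷ renL f Xs

mutual
  ren-cong : ∀ {f g} → (∀ c → f c ≡ g c) → ∀ X → ren f X ≡ ren g X
  ren-cong e (atm c)   = cong atm (e c)
  ren-cong e (and Xs)  = cong and (renL-cong e Xs)
  ren-cong e (neg X)   = cong neg (ren-cong e X)
  ren-cong e (all c X) = cong₂ all (e c) (ren-cong e X)
  ren-cong e (elt x c) = cong₂ elt (ren-cong e x) (e c)
  ren-cong e (st c X)  = cong₂ st (e c) (ren-cong e X)

  renL-cong : ∀ {f g} → (∀ c → f c ≡ g c) → ∀ Xs → renL f Xs ≡ renL g Xs
  renL-cong e []       = refl
  renL-cong e (X ∷ Xs) = cong₂ _∷_ (ren-cong e X) (renL-cong e Xs)

mutual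
  ren-∘ : ∀ f g X → ren f (ren g X) ≡ ren (f ∘ g) X
  ren-∘ f g (atm c)   = refl
  ren-∘ f g (and Xs)  = cong and (renL-∘ f g Xs)
  ren-∘ f g (neg X)   = cong neg (ren-∘ f g X)
  ren-∘ f g (all c X) = cong (all _) (ren-∘ f g X)
  ren-∘ f g (elt x c) = cong (λ y → elt y _) (ren-∘ f g x)
  ren-∘ f g (st c X)  = cong (st _) (ren-∘ f g X)

  renL-∘ : ∀ f g Xs → renL f (renL g Xs) ≡ renL (f ∘ g) Xs
  renL-∘ f g []       = refl
  renL-∘ f g (X ∷ Xs) = cong₂ _∷_ (ren-∘ f g X) (renL-∘ f g Xs)

mutual
  ren-id : ∀ X → ren id X ≡ X
  ren-id (atm c)   = refl
  ren-id (and Xs)  = cong and (renL-id Xs)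
  ren-id (neg X)   = cong neg (ren-id X)
  ren-id (all c X) = cong (all c) (ren-id X)
  ren-id (elt x c) = cong (λ y → elt y c) (ren-id x)
  ren-id (st c X)  = cong (st c) (ren-id X)

  renL-id : ∀ Xs → renL id Xs ≡ Xs
  renL-id []       = refl
  renL-id (X ∷ Xs) = cong₂ _∷_ (ren-id X) (renL-id Xs)

mutual
  swap-is-ren : ∀ a b X → swap a b X ≡ ren (swapAtom a b) X
  swap-is-ren a b (atm c)   = refl
  swap-is-ren a b (and Xs)  = cong and (swapList-is-renL a b Xs)
  swap-is-ren a b (neg X)   = cong neg (swap-is-ren a b X)
  swap-is-ren a b (all c X) = cong (all _) (swap-is-ren a b X)
  swap-is-ren a b (elt x c) = cong (λ y → elt y _) (swap-is-ren a b x)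
  swap-is-ren a b (st c X)  = cong (st _) (swap-is-ren a b X)

  swapList-is-renL : ∀ a b Xs → swapList a b Xs ≡ renL (swapAtom a b) Xs
  swapList-is-renL a b []       = refl
  swapList-is-renL a b (X ∷ Xs) = cong₂ _∷_ (swap-is-ren a b X) (swapList-is-renL a b Xs)

swap-ren : ∀ c d g X → swap c d (ren g X) ≡ ren (swapAtom c d ∘ g) X
swap-ren c d g X = trans (swap-is-ren c d (ren g X)) (ren-∘ (swapAtom c d) g X)

ren-swap-self : ∀ a X → ren (swapAtom a a) X ≡ X
ren-swap-self a X = trans (ren-cong (swap-self a) X) (ren-id X)

swap-swap : ∀ a b X → swap a b (swap b a X) ≡ X
swap-swap a b X = begin
  swap a b (swap b a X)                       ≡⟨ cong (swap a b) (swap-is-ren b a X) ⟩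
  swap a b (ren (swapAtom b a) X)             ≡⟨ swap-ren a b (swapAtom b a) X ⟩
  ren (swapAtom a b ∘ swapAtom b a) X         ≡⟨ ren-cong undo X ⟩
  ren id X                                    ≡⟨ ren-id X ⟩
  X                                           ∎
  where
  open ≡-Reasoning
  undo : ∀ c → swapAtom a b (swapAtom b a c) ≡ c
  undo c = trans (cong (swapAtom a b) (swap-comm b a c)) (swap-involutive a b c)

swap-ren-conj : (f : Ren) → ∀ b a X → swap (fn f b) (fn f a) (ren (fn f) X) ≡ ren (fn f) (swap b a X)
swap-ren-conj f b a X = begin
  swap (fn f b) (fn f a) (ren (fn f) X)       ≡⟨ swap-ren (fn f b) (fn f a) (fn f) X ⟩
  ren (swapAtom (fn f b) (fn f a) ∘ fn f) X   ≡⟨ ren-cong (swap-conj f b a) X ⟩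
  ren (fn f ∘ swapAtom b a) X                 ≡⟨ sym (ren-∘ (fn f) (swapAtom b a) X) ⟩
  ren (fn f) (ren (swapAtom b a) X)           ≡⟨ cong (ren (fn f)) (sym (swap-is-ren b a X)) ⟩
  ren (fn f) (swap b a X)                     ∎
  where open ≡-Reasoning

mutual
  fa-ren : (f : Ren) → ∀ {b} X → b ∈fa X → fn f b ∈fa ren (fn f) X
  fa-ren f (atm c)   fa-atm        = fa-atm
  fa-ren f (and Xs)  (fa-and p)    = fa-and (faL-ren f Xs p)
  fa-ren f (neg X)   (fa-neg p)    = fa-neg (fa-ren f X p)
  fa-ren f (all c X) (fa-all n p)  = fa-all (λ e → n (inj f e)) (fa-ren f X p)
  fa-ren f (elt x c) (fa-elt₁ p)   = fa-elt₁ (fa-ren f x p)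
  fa-ren f (elt x c) fa-elt₂       = fa-elt₂
  fa-ren f (st c X)  (fa-st n p)   = fa-st (λ e → n (inj f e)) (fa-ren f X p)

  faL-ren : (f : Ren) → ∀ {b} Xs → Any (b ∈fa_) Xs → Any (fn f b ∈fa_) (renL (fn f) Xs)
  faL-ren f (X ∷ Xs) (here p)  = here (fa-ren f X p)
  faL-ren f (X ∷ Xs) (there p) = there (faL-ren f Xs p)

mutual
  fa-ren⁻ : ∀ f {c} X → c ∈fa ren f X → Σ Atom λ b → b ∈fa X × f b ≡ c
  fa-ren⁻ f (atm b) fa-atm = b , fa-atm , refl
  fa-ren⁻ f (and Xs) (fa-and p) with faL-ren⁻ f Xs p
  ... | b , q , e = b , fa-and q , e
  fa-ren⁻ f (neg X) (fa-neg p) with fa-ren⁻ f X p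
  ... | b , q , e = b , fa-neg q , e
  fa-ren⁻ f (all a X) (fa-all n p) with fa-ren⁻ f X p
  ... | b , q , refl = b , fa-all (λ { refl → n refl }) q , refl
  fa-ren⁻ f (elt x a) (fa-elt₁ p) with fa-ren⁻ f x p
  ... | b , q , e = b , fa-elt₁ q , e
  fa-ren⁻ f (elt x a) fa-elt₂ = a , fa-elt₂ , refl
  fa-ren⁻ f (st a X) (fa-st n p) with fa-ren⁻ f X p
  ... | b , q , refl = b , fa-st (λ { refl → n refl }) q , refl

  faL-ren⁻ : ∀ f {c} Xs → Any (c ∈fa_) (renL f Xs) → Σ Atom λ b → Any (b ∈fa_) Xs × f b ≡ c
  faL-ren⁻ f (X ∷ Xs) (here p) with fa-ren⁻ f X p
  ... | b , q , e = b , here q , e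
  faL-ren⁻ f (X ∷ Xs) (there p) with faL-ren⁻ f Xs p
  ... | b , q , e = b , there q , e

#-ren : (f : Ren) → ∀ {b} X → b # X → fn f b # ren (fn f) X
#-ren f X n p with fa-ren⁻ (fn f) X p
... | b' , q , e with inj f e
... | refl = n q

fa-swap : ∀ {a c b X} → level a ≡ level c → b ≢ a → b ≢ c → b ∈fa X → b ∈fa swap c a X
fa-swap {a} {c} {b} {X} lv m k p rewrite swap-is-ren c a X =
  subst (_∈fa ren (swapAtom c a) X) (swap-other c a b k m) (fa-ren (swapR c a (sym lv)) X p)

fa-swap⁻ : ∀ {a c b X} → c # X → b ≢ c → b ∈fa swap c a X → b ≢ a × b ∈fa X
fa-swap⁻ {a} {c} {b} {X} fr k p rewrite swap-is-ren c a X with fa-ren⁻ (swapAtom c a) X p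
... | e , q , eq with swapCase c a e
... | is-left refl = ⊥-elim (fr q)
... | is-right _ refl rewrite swap-right c a = ⊥-elim (k (sym eq))
... | is-other n m rewrite swap-other c a e n m | eq = m , q

-- The largest atom name occurring in a term bounds its free atoms, so a
-- name above it is fresh at every level.
mutual
  maxName : Term → ℕ
  maxName (atm c)   = proj₂ c
  maxName (and Xs)  = maxNames Xs
  maxName (neg X)   = maxName X
  maxName (all c X) = proj₂ c ⊔ maxName X
  maxName (elt x c) = maxName x ⊔ proj₂ c
  maxName (st c X)  = proj₂ c ⊔ maxName X

  maxNames : List Term → ℕ
  maxNames []       = 0
  maxNames (X ∷ Xs) = maxName X ⊔ maxNames Xs

mutual
  fa-≤-maxName : ∀ {b} X → b ∈fa X → proj₂ b ℕ.≤ maxName X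
  fa-≤-maxName (atm c)   fa-atm       = ℕP.≤-refl
  fa-≤-maxName (and Xs)  (fa-and p)   = faL-≤-maxNames Xs p
  fa-≤-maxName (neg X)   (fa-neg p)   = fa-≤-maxName X p
  fa-≤-maxName (all c X) (fa-all _ p) = ℕP.≤-trans (fa-≤-maxName X p) (ℕP.m≤n⊔m (proj₂ c) (maxName X))
  fa-≤-maxName (elt x c) (fa-elt₁ p)  = ℕP.≤-trans (fa-≤-maxName x p) (ℕP.m≤m⊔n (maxName x) (proj₂ c))
  fa-≤-maxName (elt x c) fa-elt₂      = ℕP.m≤n⊔m (maxName x) (proj₂ c)
  fa-≤-maxName (st c X)  (fa-st _ p)  = ℕP.≤-trans (fa-≤-maxName X p) (ℕP.m≤n⊔m (proj₂ c) (maxName X))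

  faL-≤-maxNames : ∀ {b} Xs → Any (b ∈fa_) Xs → proj₂ b ℕ.≤ maxNames Xs
  faL-≤-maxNames (X ∷ Xs) (here p)  = ℕP.≤-trans (fa-≤-maxName X p) (ℕP.m≤m⊔n (maxName X) (maxNames Xs))
  faL-≤-maxNames (X ∷ Xs) (there p) = ℕP.≤-trans (faL-≤-maxNames Xs p) (ℕP.m≤n⊔m (maxName X) (maxNames Xs))

fresh : (ℓ : ℤ) (T : Term) → Σ Atom λ b → level b ≡ ℓ × b # T
fresh ℓ T = (ℓ , suc (maxName T)) , refl , λ p → ℕP.n≮n (maxName T) (fa-≤-maxName T p)

diagonal : ∀ {A : Set} {R : A → A → Set} {xs} → All (λ x → R x x) xs → All (λ x → Any (R x) xs) xs
diagonal []       = []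
diagonal (p ∷ ps) = here p ∷ All.map there (diagonal ps)

diagonal' : ∀ {A : Set} {R : A → A → Set} {xs} → All (λ x → R x x) xs → All (λ x → Any (λ y → R y x) xs) xs
diagonal' []       = []
diagonal' (p ∷ ps) = here p ∷ All.map there (diagonal' ps)

mutual
  ≈-refl : ∀ X → X ≈α X
  ≈-refl (atm a)   = atm≈
  ≈-refl (and Xs)  = and≈ (diagonal (≈-reflL Xs)) (diagonal' (≈-reflL Xs))
  ≈-refl (neg X)   = neg≈ (≈-refl X)
  ≈-refl (all a X) = all≈ (≈-refl X)
  ≈-refl (elt x a) = elt≈ (≈-refl x)
  ≈-refl (st a X)  = st≈ (≈-refl X)

  ≈-reflL : ∀ Xs → All (λ X → X ≈α X) Xs
  ≈-reflL []       = []
  ≈-reflL (X ∷ Xs) = ≈-refl X ∷ ≈-reflL Xs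

≈-reflexive : ∀ {X Y} → X ≡ Y → X ≈α Y
≈-reflexive {X} refl = ≈-refl X

mutual
  fa-≈ : ∀ {X Y b} → X ≈α Y → (b ∈fa X → b ∈fa Y) × (b ∈fa Y → b ∈fa X)
  fa-≈ atm≈ = id , id
  fa-≈ (and≈ ps qs) = (λ { (fa-and p) → fa-and (fa-≈-fwd ps p) }) , (λ { (fa-and p) → fa-and (fa-≈-bwd qs p) })
  fa-≈ (neg≈ d) = (λ { (fa-neg p) → fa-neg (proj₁ (fa-≈ d) p) }) , (λ { (fa-neg p) → fa-neg (proj₂ (fa-≈ d) p) })
  fa-≈ (all≈ d) = (λ { (fa-all n p) → fa-all n (proj₁ (fa-≈ d) p) }) , (λ { (fa-all n p) → fa-all n (proj₂ (fa-≈ d) p) })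
  fa-≈ (all≈' n lv fr d) =
    (λ { (fa-all m p) → fa-all (λ { refl → fr p }) (proj₁ (fa-≈ d) (fa-swap lv m (λ { refl → fr p }) p)) }) ,
    (λ { (fa-all m p) → let r = fa-swap⁻ fr m (proj₂ (fa-≈ d) p) in fa-all (proj₁ r) (proj₂ r) })
  fa-≈ (elt≈ d) = (λ { (fa-elt₁ p) → fa-elt₁ (proj₁ (fa-≈ d) p) ; fa-elt₂ → fa-elt₂ }) ,
                  (λ { (fa-elt₁ p) → fa-elt₁ (proj₂ (fa-≈ d) p) ; fa-elt₂ → fa-elt₂ })
  fa-≈ (st≈ d) = (λ { (fa-st n p) → fa-st n (proj₁ (fa-≈ d) p) }) , (λ { (fa-st n p) → fa-st n (proj₂ (fa-≈ d) p) })
  fa-≈ (st≈' n lv fr d) =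
    (λ { (fa-st m p) → fa-st (λ { refl → fr p }) (proj₁ (fa-≈ d) (fa-swap lv m (λ { refl → fr p }) p)) }) ,
    (λ { (fa-st m p) → let r = fa-swap⁻ fr m (proj₂ (fa-≈ d) p) in fa-st (proj₁ r) (proj₂ r) })

  fa-≈-fwd : ∀ {Xs Ys b} → All (λ X → Any (X ≈α_) Ys) Xs → Any (b ∈fa_) Xs → Any (b ∈fa_) Ys
  fa-≈-fwd (p ∷ ps) (here q)  = fa-≈-fwd₁ p q
  fa-≈-fwd (p ∷ ps) (there q) = fa-≈-fwd ps q

  fa-≈-fwd₁ : ∀ {X Ys b} → Any (X ≈α_) Ys → b ∈fa X → Any (b ∈fa_) Ys
  fa-≈-fwd₁ (here d)  q = here (proj₁ (fa-≈ d) q)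
  fa-≈-fwd₁ (there d) q = there (fa-≈-fwd₁ d q)

  fa-≈-bwd : ∀ {Xs Ys b} → All (λ Y → Any (_≈α Y) Xs) Ys → Any (b ∈fa_) Ys → Any (b ∈fa_) Xs
  fa-≈-bwd (p ∷ ps) (here q)  = fa-≈-bwd₁ p q
  fa-≈-bwd (p ∷ ps) (there q) = fa-≈-bwd ps q

  fa-≈-bwd₁ : ∀ {Y Xs b} → Any (_≈α Y) Xs → b ∈fa Y → Any (b ∈fa_) Xs
  fa-≈-bwd₁ (here d)  q = here (proj₂ (fa-≈ d) q)
  fa-≈-bwd₁ (there d) q = there (fa-≈-bwd₁ d q)

mutual
  ≈-ren : (f : Ren) → ∀ {X Y} → X ≈α Y → ren (fn f) X ≈α ren (fn f) Y
  ≈-ren f atm≈ = atm≈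
  ≈-ren f (and≈ ps qs) = and≈ (≈-renF f ps) (≈-renB f qs)
  ≈-ren f (neg≈ d) = neg≈ (≈-ren f d)
  ≈-ren f (all≈ d) = all≈ (≈-ren f d)
  ≈-ren f (all≈' {a} {b} {X} n lv fr d) =
    all≈' (λ e → n (inj f e)) (trans (lev f a) (trans lv (sym (lev f b)))) (#-ren f X fr)
          (subst (_≈α _) (sym (swap-ren-conj f b a X)) (≈-ren f d))
  ≈-ren f (elt≈ d) = elt≈ (≈-ren f d)
  ≈-ren f (st≈ d) = st≈ (≈-ren f d)
  ≈-ren f (st≈' {a} {b} {X} n lv fr d) =
    st≈' (λ e → n (inj f e)) (trans (lev f a) (trans lv (sym (lev f b)))) (#-ren f X fr)
         (subst (_≈α _) (sym (swap-ren-conj f b a X)) (≈-ren f d))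

  ≈-renF : (f : Ren) → ∀ {Xs Ys} → All (λ X → Any (X ≈α_) Ys) Xs →
           All (λ X → Any (X ≈α_) (renL (fn f) Ys)) (renL (fn f) Xs)
  ≈-renF f []       = []
  ≈-renF f (p ∷ ps) = ≈-renF₁ f p ∷ ≈-renF f ps

  ≈-renF₁ : (f : Ren) → ∀ {X Ys} → Any (X ≈α_) Ys → Any (ren (fn f) X ≈α_) (renL (fn f) Ys)
  ≈-renF₁ f (here d)  = here (≈-ren f d)
  ≈-renF₁ f (there p) = there (≈-renF₁ f p)

  ≈-renB : (f : Ren) → ∀ {Xs Ys} → All (λ Y → Any (_≈α Y) Xs) Ys →
           All (λ Y → Any (_≈α Y) (renL (fn f) Xs)) (renL (fn f) Ys)
  ≈-renB f []       = []
  ≈-renB f (p ∷ ps) = ≈-renB₁ f p ∷ ≈-renB f ps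

  ≈-renB₁ : (f : Ren) → ∀ {Y Xs} → Any (_≈α Y) Xs → Any (_≈α ren (fn f) Y) (renL (fn f) Xs)
  ≈-renB₁ f (here d)  = here (≈-ren f d)
  ≈-renB₁ f (there p) = there (≈-renB₁ f p)

-- The data of a renaming abstraction [a]X = [b]Y, a ≠ b, read backwards;
-- the second hypothesis is the symmetric image of the first.
abs-sym : ∀ {a b X Y} → a ≢ b → level a ≡ level b → b # X → swap b a X ≈α Y → Y ≈α swap b a X →
          b ≢ a × level b ≡ level a × a # Y × swap a b Y ≈α X
abs-sym {a} {b} {X} {Y} n lv fr d s = (λ e → n (sym e)) , sym lv , a#Y , back
  where
  a#Y : a # Y
  a#Y p with fa-ren⁻ (swapAtom b a) X (subst (a ∈fa_) (swap-is-ren b a X) (proj₂ (fa-≈ d) p))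
  ... | e , q , eq = fr (subst (_∈fa X) (swap-injective b a (trans eq (sym (swap-left b a)))) q)
  back : swap a b Y ≈α X
  back = subst (swap a b Y ≈α_) (swap-swap a b X)
           (subst₂ _≈α_ (sym (swap-is-ren a b Y)) (sym (swap-is-ren a b _)) (≈-ren (swapR a b lv) s))

mutual
  ≈-sym : ∀ {X Y} → X ≈α Y → Y ≈α X
  ≈-sym atm≈ = atm≈
  ≈-sym (and≈ ps qs) = and≈ (≈-symB qs) (≈-symF ps)
  ≈-sym (neg≈ d) = neg≈ (≈-sym d)
  ≈-sym (all≈ d) = all≈ (≈-sym d)
  ≈-sym (all≈' n lv fr d) with abs-sym n lv fr d (≈-sym d)
  ... | n' , lv' , fr' , d' = all≈' n' lv' fr' d'
  ≈-sym (elt≈ d) = elt≈ (≈-sym d)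
  ≈-sym (st≈ d) = st≈ (≈-sym d)
  ≈-sym (st≈' n lv fr d) with abs-sym n lv fr d (≈-sym d)
  ... | n' , lv' , fr' , d' = st≈' n' lv' fr' d'

  ≈-symB : ∀ {Xs Ys} → All (λ Y → Any (_≈α Y) Xs) Ys → All (λ Y → Any (Y ≈α_) Xs) Ys
  ≈-symB []       = []
  ≈-symB (p ∷ ps) = ≈-sym₁ p ∷ ≈-symB ps

  ≈-sym₁ : ∀ {Y Xs} → Any (_≈α Y) Xs → Any (Y ≈α_) Xs
  ≈-sym₁ (here d)  = here (≈-sym d)
  ≈-sym₁ (there p) = there (≈-sym₁ p)

  ≈-symF : ∀ {Xs Ys} → All (λ X → Any (X ≈α_) Ys) Xs → All (λ X → Any (_≈α X) Ys) Xs
  ≈-symF []       = []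
  ≈-symF (p ∷ ps) = ≈-sym₁' p ∷ ≈-symF ps

  ≈-sym₁' : ∀ {X Ys} → Any (X ≈α_) Ys → Any (_≈α X) Ys
  ≈-sym₁' (here d)  = here (≈-sym d)
  ≈-sym₁' (there p) = there (≈-sym₁' p)

AbsR : Atom → Term → Atom → Term → Set
AbsR a X b Y = (a ≡ b × X ≈α Y) ⊎ (a ≢ b × level a ≡ level b × b # X × swap b a X ≈α Y)

abs-all : ∀ {a X b Y} → AbsR a X b Y → all a X ≈α all b Y
abs-all (inj₁ (refl , d))        = all≈ d
abs-all (inj₂ (n , lv , fr , d)) = all≈' n lv fr d

abs-st : ∀ {a X b Y} → AbsR a X b Y → st a X ≈α st b Y
abs-st (inj₁ (refl , d))        = st≈ d
abs-st (inj₂ (n , lv , fr , d)) = st≈' n lv fr d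

inv-atm : ∀ {c Z} → atm c ≈α Z → Z ≡ atm c
inv-atm atm≈ = refl

inv-and : ∀ {Xs Z} → and Xs ≈α Z → Σ (List Term) λ Ys → Z ≡ and Ys ×
          All (λ X → Any (X ≈α_) Ys) Xs × All (λ Y → Any (_≈α Y) Xs) Ys
inv-and (and≈ ps qs) = _ , refl , ps , qs

inv-neg : ∀ {X Z} → neg X ≈α Z → Σ Term λ Y → Z ≡ neg Y × X ≈α Y
inv-neg (neg≈ d) = _ , refl , d

inv-elt : ∀ {x a Z} → elt x a ≈α Z → Σ Term λ y → Z ≡ elt y a × x ≈α y
inv-elt (elt≈ d) = _ , refl , d

inv-all : ∀ {a X Z} → all a X ≈α Z → Σ Atom λ b → Σ Term λ Y → Z ≡ all b Y × AbsR a X b Y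
inv-all (all≈ d)          = _ , _ , refl , inj₁ (refl , d)
inv-all (all≈' n lv fr d) = _ , _ , refl , inj₂ (n , lv , fr , d)

inv-st : ∀ {a X Z} → st a X ≈α Z → Σ Atom λ b → Σ Term λ Y → Z ≡ st b Y × AbsR a X b Y
inv-st (st≈ d)          = _ , _ , refl , inj₁ (refl , d)
inv-st (st≈' n lv fr d) = _ , _ , refl , inj₂ (n , lv , fr , d)

Agree : Ren → Ren → Term → Set
Agree f g X = ∀ e → e ∈fa X → fn f e ≡ fn g e

AgreeL : Ren → Ren → List Term → Set
AgreeL f g Xs = ∀ e → Any (e ∈fa_) Xs → fn f e ≡ fn g e

RenamedAbs : Ren → Atom → Term → Atom → Term → Set
RenamedAbs g b Y c W = (c ≡ fn g b ⊎ c # ren (fn g) Y) × level c ≡ level (fn g b) ×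
                       ren (swapAtom c (fn g b) ∘ fn g) Y ≈α W

renamedAbs : (g : Ren) → ∀ {b Y c W} → AbsR (fn g b) (ren (fn g) Y) c W → RenamedAbs g b Y c W
renamedAbs g {b} {Y} (inj₁ (refl , d)) =
  inj₁ refl , refl , subst (_≈α _) (sym (ren-cong (λ c → swap-self (fn g b) (fn g c)) Y)) d
renamedAbs g {b} {Y} {c} (inj₂ (_ , lv , fr , d)) =
  inj₂ fr , sym lv , subst (_≈α _) (swap-ren c (fn g b) (fn g) Y) d

-- The binder case of ≈-trans-ren.  [a]X ≈α [b]Y is given through the body
-- X₁ = (b a)·X (b = a or b fresh for X), whose free atoms lie in Y; the
-- induction hypothesis for X₁ is applied to the renamings g' = (c  g b)∘g
-- and f' = (c  f a)∘f∘(b a), which agree on X₁.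
abs-trans : ∀ {a b X Y X₁ c W} (g f : Ren) →
  X₁ ≡ ren (swapAtom b a) X → (b ≡ a ⊎ b # X) → (lv : level b ≡ level a) →
  (∀ d → d ∈fa X₁ → d ∈fa Y) → RenamedAbs g b Y c W →
  (∀ e → e ∈fa X → e ≢ a → fn f e ≡ fn g e) →
  ((g' f' : Ren) → ren (fn g') Y ≈α W → Agree f' g' X₁ → ren (fn f') X₁ ≈α W) →
  AbsR (fn f a) (ren (fn f) X) c W
abs-trans {a} {b} {X} {Y} {X₁} {c} {W} g f refl b-ok lv faX₁ (c-ok , lvc , body) agree ih =
  conclude (fn f a ≟ₐ c)
  where
  level-c : level c ≡ level (fn f a)
  level-c = trans lvc (trans (lev g b) (trans lv (sym (lev f a))))
  g' : Ren
  g' = swapR c (fn g b) lvc ∘R g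
  f' : Ren
  f' = swapR c (fn f a) level-c ∘R (f ∘R swapR b a lv)
  e≢b : ∀ e → e ∈fa X → e ≢ a → e ≢ b
  e≢b e p n refl = [ n , (λ fr → fr p) ] b-ok
  g-avoids-c : ∀ e → e ∈fa X → e ≢ a → fn g e ≢ c
  g-avoids-c e p n eq = [ (λ h → e≢b e p n (inj g (trans eq h))) , (λ fr → fr (subst (_∈fa ren (fn g) Y) eq
    (fa-ren g Y (faX₁ e (subst (_∈fa ren (swapAtom b a) X) (swap-other b a e (e≢b e p n) n)
      (fa-ren (swapR b a lv) X p)))))) ] c-ok
  agree' : Agree f' g' (ren (swapAtom b a) X)
  agree' d p with fa-ren⁻ (swapAtom b a) X p
  ... | e , q , refl with e ≟ₐ a
  ...   | yes refl rewrite swap-involutive b a a | swap-right b a | swap-right c (fn f a) | swap-right c (fn g b) = refl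
  ...   | no n rewrite swap-involutive b a e | swap-other b a e (e≢b e q n) n | agree e q n
            = trans (swap-other c (fn f a) (fn g e) (g-avoids-c e q n) (λ h → n (inj f (trans (agree e q n) h))))
                    (sym (swap-other c (fn g b) (fn g e) (g-avoids-c e q n) (λ h → e≢b e q n (inj g h))))
  D : ren (fn f') (ren (swapAtom b a) X) ≈α W
  D = ih g' f' body agree'
  f'X₁ : ren (fn f') (ren (swapAtom b a) X) ≡ swap c (fn f a) (ren (fn f) X)
  f'X₁ = trans (ren-∘ (fn f') (swapAtom b a) X)
         (trans (ren-cong (λ e → cong (λ z → swapAtom c (fn f a) (fn f z)) (swap-involutive b a e)) X)
         (sym (swap-ren c (fn f a) (fn f) X)))
  c#fX : fn f a ≢ c → c # ren (fn f) X
  c#fX n p with fa-ren⁻ (fn f) X p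
  ... | e , q , eq with e ≟ₐ a
  ...   | yes refl = n eq
  ...   | no m = g-avoids-c e q m (trans (sym (agree e q m)) eq)
  conclude : Dec (fn f a ≡ c) → AbsR (fn f a) (ren (fn f) X) c W
  conclude (yes refl) = inj₁ (refl , subst (_≈α W) (trans f'X₁ (trans (swap-is-ren c c _) (ren-swap-self c _))) D)
  conclude (no n)     = inj₂ (n , sym level-c , c#fX n , subst (_≈α W) f'X₁ D)

-- If X ≈α Y, g(Y) ≈α W and f agrees with g on the free atoms of X, then
-- f(X) ≈α W.  The binder cases only need the induction hypothesis on the
-- body, at other renamings (abs-trans).
mutual
  ≈-trans-ren : ∀ {X Y W} → X ≈α Y → (g f : Ren) → ren (fn g) Y ≈α W → Agree f g X → ren (fn f) X ≈α W
  ≈-trans-ren atm≈ g f atm≈ agree rewrite agree _ fa-atm = atm≈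
  ≈-trans-ren (and≈ ps qs) g f (and≈ ps' qs') agree =
    and≈ (≈-trans-renF g f ps ps' (λ e p → agree e (fa-and p))) (≈-trans-renB g f qs qs' (λ e p → agree e (fa-and p)))
  ≈-trans-ren (neg≈ d) g f (neg≈ e) agree = neg≈ (≈-trans-ren d g f e (λ x p → agree x (fa-neg p)))
  ≈-trans-ren (elt≈ d) g f (elt≈ e) agree rewrite agree _ fa-elt₂ =
    elt≈ (≈-trans-ren d g f e (λ x p → agree x (fa-elt₁ p)))
  ≈-trans-ren (all≈ d) g f e agree with inv-all e
  ... | _ , _ , refl , ab = abs-all (abs-trans g f (sym (ren-swap-self _ _)) (inj₁ refl) refl
    (λ _ → proj₁ (fa-≈ d)) (renamedAbs g ab) (λ x p n → agree x (fa-all n p)) (λ g' f' → ≈-trans-ren d g' f'))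
  ≈-trans-ren (all≈' _ lv fr d) g f e agree with inv-all e
  ... | _ , _ , refl , ab = abs-all (abs-trans g f (swap-is-ren _ _ _) (inj₂ fr) (sym lv)
    (λ _ → proj₁ (fa-≈ d)) (renamedAbs g ab) (λ x p n → agree x (fa-all n p)) (λ g' f' → ≈-trans-ren d g' f'))
  ≈-trans-ren (st≈ d) g f e agree with inv-st e
  ... | _ , _ , refl , ab = abs-st (abs-trans g f (sym (ren-swap-self _ _)) (inj₁ refl) refl
    (λ _ → proj₁ (fa-≈ d)) (renamedAbs g ab) (λ x p n → agree x (fa-st n p)) (λ g' f' → ≈-trans-ren d g' f'))
  ≈-trans-ren (st≈' _ lv fr d) g f e agree with inv-st e
  ... | _ , _ , refl , ab = abs-st (abs-trans g f (swap-is-ren _ _ _) (inj₂ fr) (sym lv)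
    (λ _ → proj₁ (fa-≈ d)) (renamedAbs g ab) (λ x p n → agree x (fa-st n p)) (λ g' f' → ≈-trans-ren d g' f'))

  ≈-trans-renF : (g f : Ren) → ∀ {Xs Ys Ws} → All (λ X → Any (X ≈α_) Ys) Xs →
                 All (λ Y → Any (Y ≈α_) Ws) (renL (fn g) Ys) → AgreeL f g Xs → All (λ X → Any (X ≈α_) Ws) (renL (fn f) Xs)
  ≈-trans-renF g f [] ps' agree = []
  ≈-trans-renF g f (p ∷ ps) ps' agree =
    ≈-trans-renF₁ g f p ps' (λ e q → agree e (here q)) ∷ ≈-trans-renF g f ps ps' (λ e q → agree e (there q))

  ≈-trans-renF₁ : (g f : Ren) → ∀ {X Ys Ws} → Any (X ≈α_) Ys → All (λ Y → Any (Y ≈α_) Ws) (renL (fn g) Ys) →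
                  Agree f g X → Any (ren (fn f) X ≈α_) Ws
  ≈-trans-renF₁ g f {Ys = Y ∷ Ys} (here d)  (p' ∷ _)   agree = Any.map (λ e → ≈-trans-ren d g f e agree) p'
  ≈-trans-renF₁ g f {Ys = Y ∷ Ys} (there p) (_ ∷ ps') agree = ≈-trans-renF₁ g f p ps' agree

  ≈-trans-renB : (g f : Ren) → ∀ {Xs Ys Ws} → All (λ Y → Any (_≈α Y) Xs) Ys →
                 All (λ W → Any (_≈α W) (renL (fn g) Ys)) Ws → AgreeL f g Xs → All (λ W → Any (_≈α W) (renL (fn f) Xs)) Ws
  ≈-trans-renB g f qs []         agree = []
  ≈-trans-renB g f qs (q' ∷ qs') agree = ≈-trans-renB₁ g f qs q' agree ∷ ≈-trans-renB g f qs qs' agree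

  ≈-trans-renB₁ : (g f : Ren) → ∀ {Xs Ys W} → All (λ Y → Any (_≈α Y) Xs) Ys → Any (_≈α W) (renL (fn g) Ys) →
                  AgreeL f g Xs → Any (_≈α W) (renL (fn f) Xs)
  ≈-trans-renB₁ g f {Ys = Y ∷ Ys} (q ∷ qs) (here e)  agree = ≈-trans-renB₂ g f q e agree
  ≈-trans-renB₁ g f {Ys = Y ∷ Ys} (q ∷ qs) (there p) agree = ≈-trans-renB₁ g f qs p agree

  ≈-trans-renB₂ : (g f : Ren) → ∀ {Xs Y W} → Any (_≈α Y) Xs → ren (fn g) Y ≈α W → AgreeL f g Xs →
                  Any (_≈α W) (renL (fn f) Xs)
  ≈-trans-renB₂ g f {Xs = X ∷ Xs} (here d)  e agree = here (≈-trans-ren d g f e (λ x p → agree x (here p)))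
  ≈-trans-renB₂ g f {Xs = X ∷ Xs} (there q) e agree = there (≈-trans-renB₂ g f q e (λ x p → agree x (there p)))

≈-trans : ∀ {X Y W} → X ≈α Y → Y ≈α W → X ≈α W
≈-trans {X} {Y} d e =
  subst (_≈α _) (ren-id X) (≈-trans-ren d idR idR (subst (_≈α _) (sym (ren-id Y)) e) (λ _ _ → refl))

≈-support : (f g : Ren) → ∀ X → Agree f g X → ren (fn f) X ≈α ren (fn g) X
≈-support f g X agree = ≈-trans-ren (≈-refl X) g f (≈-refl _) agree

mutual
  fa-subst : ∀ {a x Z R e} → Subst a x Z R → e ∈fa R → e ∈fa x ⊎ (e ≢ a × e ∈fa Z)
  fa-subst (σ-α dx dZ dR D) p with fa-subst D (proj₂ (fa-≈ dR) p)
  ... | inj₁ q = inj₁ (proj₂ (fa-≈ dx) q)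
  ... | inj₂ (k , q) = inj₂ (k , proj₂ (fa-≈ dZ) q)
  fa-subst (σ-and P) (fa-and p) with fa-substL P p
  ... | inj₁ q = inj₁ q
  ... | inj₂ (k , q) = inj₂ (k , fa-and q)
  fa-subst (σ-neg D) (fa-neg p) with fa-subst D p
  ... | inj₁ q = inj₁ q
  ... | inj₂ (k , q) = inj₂ (k , fa-neg q)
  fa-subst (σ-all n fr D) (fa-all m p) with fa-subst D p
  ... | inj₁ q = inj₁ q
  ... | inj₂ (k , q) = inj₂ (k , fa-all m q)
  fa-subst (σ-elt-atm lv D) (fa-elt₁ p) with fa-subst D p
  ... | inj₁ q = inj₁ q
  ... | inj₂ (k , q) = inj₂ (k , fa-elt₁ q)
  fa-subst (σ-elt-atm lv D) fa-elt₂ = inj₁ fa-atm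
  fa-subst (σ-elt-st lv fr D₁ D₂) p with fa-subst D₂ p
  ... | inj₂ (k , q) = inj₁ (fa-st k q)
  ... | inj₁ q with fa-subst D₁ q
  ...   | inj₁ r = inj₁ r
  ...   | inj₂ (k , r) = inj₂ (k , fa-elt₁ r)
  fa-subst (σ-elt n D) (fa-elt₁ p) with fa-subst D p
  ... | inj₁ q = inj₁ q
  ... | inj₂ (k , q) = inj₂ (k , fa-elt₁ q)
  fa-subst (σ-elt n D) fa-elt₂ = inj₂ (n , fa-elt₂)
  fa-subst σ-atm p = inj₁ p
  fa-subst (σ-atm' n) fa-atm = inj₂ (n , fa-atm)
  fa-subst (σ-st n fr D) (fa-st m p) with fa-subst D p
  ... | inj₁ q = inj₁ q
  ... | inj₂ (k , q) = inj₂ (k , fa-st m q)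

  fa-substL : ∀ {a x Xs Rs e} → Pointwise (Subst a x) Xs Rs → Any (e ∈fa_) Rs → e ∈fa x ⊎ (e ≢ a × Any (e ∈fa_) Xs)
  fa-substL (D ∷ P) (here p) with fa-subst D p
  ... | inj₁ q = inj₁ q
  ... | inj₂ (k , q) = inj₂ (k , here q)
  fa-substL (D ∷ P) (there p) with fa-substL P p
  ... | inj₁ q = inj₁ q
  ... | inj₂ (k , q) = inj₂ (k , there q)

fa-subst' : ∀ {a x X R} → Subst a x X R → ∀ e → e ∈fa R → e ∈fa x ⊎ e ∈fa X
fa-subst' D e p = [ inj₁ , (λ q → inj₂ (proj₂ q)) ] (fa-subst D p)

data SubstStep (a : Atom) : Term → Term → Term → Set where
  s-and     : ∀ {x Xs Rs} → Pointwise (Subst a x) Xs Rs → SubstStep a x (and Xs) (and Rs)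
  s-neg     : ∀ {x X R} → Subst a x X R → SubstStep a x (neg X) (neg R)
  s-all     : ∀ {x b X R} → b ≢ a → b # x → Subst a x X R → SubstStep a x (all b X) (all b R)
  s-elt-atm : ∀ {y n R} → level n ≡ level a → Subst a (atm n) y R → SubstStep a (atm n) (elt y a) (elt R n)
  s-elt-st  : ∀ {y a' X' y' R} → level a' ≡ level a - 1ℤ → a' # y → Subst a (st a' X') y y' →
              Subst a' y' X' R → SubstStep a (st a' X') (elt y a) R
  s-elt     : ∀ {x y b R} → b ≢ a → Subst a x y R → SubstStep a x (elt y b) (elt R b)
  s-atm     : ∀ {x} → SubstStep a x (atm a) x
  s-atm'    : ∀ {x b} → b ≢ a → SubstStep a x (atm b) (atm b)
  s-st      : ∀ {x c X R} → c ≢ a → c # x → Subst a x X R → SubstStep a x (st c X) (st c R)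

subst-step : ∀ {a x Z R} → Subst a x Z R →
  Σ Term λ x₀ → Σ Term λ Z₀ → Σ Term λ R₀ → x ≈α x₀ × Z ≈α Z₀ × R₀ ≈α R × SubstStep a x₀ Z₀ R₀
subst-step (σ-α dx dZ dR D) with subst-step D
... | x₀ , Z₀ , R₀ , ex , eZ , eR , S = x₀ , Z₀ , R₀ , ≈-trans dx ex , ≈-trans dZ eZ , ≈-trans eR dR , S
subst-step (σ-and P)              = _ , _ , _ , ≈-refl _ , ≈-refl _ , ≈-refl _ , s-and P
subst-step (σ-neg D)              = _ , _ , _ , ≈-refl _ , ≈-refl _ , ≈-refl _ , s-neg D
subst-step (σ-all n fr D)         = _ , _ , _ , ≈-refl _ , ≈-refl _ , ≈-refl _ , s-all n fr D
subst-step (σ-elt-atm lv D)       = _ , _ , _ , ≈-refl _ , ≈-refl _ , ≈-refl _ , s-elt-atm lv D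
subst-step (σ-elt-st lv fr D₁ D₂) = _ , _ , _ , ≈-refl _ , ≈-refl _ , ≈-refl _ , s-elt-st lv fr D₁ D₂
subst-step (σ-elt n D)            = _ , _ , _ , ≈-refl _ , ≈-refl _ , ≈-refl _ , s-elt n D
subst-step σ-atm                  = _ , _ , _ , ≈-refl _ , ≈-refl _ , ≈-refl _ , s-atm
subst-step (σ-atm' n)             = _ , _ , _ , ≈-refl _ , ≈-refl _ , ≈-refl _ , s-atm' n
subst-step (σ-st n fr D)          = _ , _ , _ , ≈-refl _ , ≈-refl _ , ≈-refl _ , s-st n fr D

-- When c ≠ f b, the renaming used is f' = (c  f b)∘f, which still maps x
-- to x₀ because both binders are fresh for it.
abs-equivariant : ∀ {a x X R₁ b a' x₀ c X₀ R₁'} (f : Ren) →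
  b ≢ a → b # x → fn f a ≡ a' → ren (fn f) x ≈α x₀ → c ≢ a' → c # x₀ →
  (∀ e → e ∈fa R₁ → e ∈fa x ⊎ e ∈fa X) → AbsR (fn f b) (ren (fn f) X) c X₀ →
  ((f' : Ren) → fn f' a ≡ a' → ren (fn f') x ≈α x₀ → ren (fn f') X ≈α X₀ → ren (fn f') R₁ ≈α R₁') →
  AbsR (fn f b) (ren (fn f) R₁) c R₁'
abs-equivariant f n fr ea ex n' fr' faR (inj₁ (refl , d)) ih = inj₁ (refl , ih f ea ex d)
abs-equivariant {a} {x} {X} {R₁} {b} {a'} {x₀} {c} {X₀} {R₁'} f n fr ea ex n' fr' faR (inj₂ (m , lv , frX , d)) ih =
  inj₂ (m , lv , c#fR , subst (_≈α _) (sym (swap-ren c (fn f b) (fn f) R₁)) (ih f' ea' ex' eX))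
  where
  f' : Ren
  f' = swapR c (fn f b) (sym lv) ∘R f
  ea' : swapAtom c (fn f b) (fn f a) ≡ a'
  ea' = trans (swap-other c (fn f b) (fn f a) (λ h → n' (trans (sym h) ea)) (λ h → n (sym (inj f h)))) ea
  f'-fixes-x : Agree f' f x
  f'-fixes-x e p = swap-other _ _ _ (λ h → fr' (subst (_∈fa x₀) h (proj₁ (fa-≈ ex) (fa-ren f x p))))
                                   (λ h → fr (subst (_∈fa x) (inj f h) p))
  ex' : ren (fn f') x ≈α x₀
  ex' = ≈-trans (≈-support f' f x f'-fixes-x) ex
  eX : ren (fn f') X ≈α X₀
  eX = subst (_≈α _) (swap-ren c (fn f b) (fn f) X) d
  c#fR : c # ren (fn f) R₁
  c#fR p with fa-ren⁻ (fn f) R₁ p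
  ... | e , q , refl with faR e q
  ... | inj₁ r = fr' (proj₁ (fa-≈ ex) (fa-ren f x r))
  ... | inj₂ r = frX (fa-ren f X r)

-- The clause elt(y, a)[a ↦ st([a₁]X₁)] = X₁[a₁ ↦ y[a ↦ st([a₁]X₁)]] is
-- equivariant, given that its two sub-substitutions are (for all
-- renamings); as above, a second binder c is reached by (c  f a₁)∘f.
elt-st-equivariant : ∀ {a a₁ X₁ y y₁ R c X₀ y₀ y₁' R₀ a'} (f : Ren) →
  a₁ # y → Subst a (st a₁ X₁) y y₁ → Subst a₁ y₁ X₁ R →
  c # y₀ → Subst a' (st c X₀) y₀ y₁' → Subst c y₁' X₀ R₀ →
  AbsR (fn f a₁) (ren (fn f) X₁) c X₀ → ren (fn f) y₁ ≈α y₁' →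
  ((f' : Ren) → fn f' a₁ ≡ c → ren (fn f') y₁ ≈α y₁' → ren (fn f') X₁ ≈α X₀ → ren (fn f') R ≈α R₀) →
  ren (fn f) R ≈α R₀
elt-st-equivariant f fr D₁ D₂ fr' D₁' D₂' (inj₁ (refl , dX)) ey ih = ih f refl ey dX
elt-st-equivariant {a₁ = a₁} {X₁} {y₁ = y₁} {R} {c} {X₀} {y₁' = y₁'} f fr D₁ D₂ fr' D₁' D₂' (inj₂ (m , lv , frX , dX)) ey ih =
  ≈-trans (≈-support f f' R f-agrees-on-R) (ih f' (swap-right c (fn f a₁)) ey' eX)
  where
  f' : Ren
  f' = swapR c (fn f a₁) (sym lv) ∘R f
  c#y₁' : c # y₁'
  c#y₁' p with fa-subst D₁' p
  ... | inj₁ (fa-st k _) = k refl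
  ... | inj₂ (_ , q) = fr' q
  a₁#y₁ : ∀ e → e ∈fa y₁ → e ≢ a₁
  a₁#y₁ e p with fa-subst D₁ p
  ... | inj₁ (fa-st k _) = k
  ... | inj₂ (_ , q) = λ { refl → fr q }
  f'-fixes-y₁ : Agree f' f y₁
  f'-fixes-y₁ e p = swap-other c (fn f a₁) (fn f e)
    (λ h → c#y₁' (subst (_∈fa y₁') h (proj₁ (fa-≈ ey) (fa-ren f y₁ p)))) (λ h → a₁#y₁ e p (inj f h))
  ey' : ren (fn f') y₁ ≈α y₁'
  ey' = ≈-trans (≈-support f' f y₁ f'-fixes-y₁) ey
  eX : ren (fn f') X₁ ≈α X₀
  eX = subst (_≈α _) (swap-ren c (fn f a₁) (fn f) X₁) dX
  f-agrees-on-R : Agree f f' R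
  f-agrees-on-R e p with fa-subst D₂ p
  ... | inj₁ q = sym (f'-fixes-y₁ e q)
  ... | inj₂ (k , q) = sym (swap-other c (fn f a₁) (fn f e)
                             (λ h → frX (subst (_∈fa _) h (fa-ren f X₁ q))) (λ h → k (inj f h)))

-- Induction on the first
-- derivation; the second is first brought to a defining clause.
mutual
  subst-equivariant : ∀ {a x Z R a' x' Z' R'} → Subst a x Z R → (f : Ren) → Subst a' x' Z' R' → fn f a ≡ a' →
      ren (fn f) x ≈α x' → ren (fn f) Z ≈α Z' → ren (fn f) R ≈α R'
  subst-equivariant D f D' ea ex eZ with subst-step D'
  ... | x₀ , Z₀ , R₀ , ex' , eZ' , eR' , S = ≈-trans (equivariant-step D f S ea (≈-trans ex ex') (≈-trans eZ eZ')) eR'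

  equivariant-step : ∀ {a x Z R a' x₀ Z₀ R₀} → Subst a x Z R → (f : Ren) → SubstStep a' x₀ Z₀ R₀ → fn f a ≡ a' →
      ren (fn f) x ≈α x₀ → ren (fn f) Z ≈α Z₀ → ren (fn f) R ≈α R₀
  equivariant-step (σ-α dx dZ dR D) f S ea ex eZ =
    ≈-trans (≈-ren f (≈-sym dR))
            (equivariant-step D f S ea (≈-trans (≈-ren f (≈-sym dx)) ex) (≈-trans (≈-ren f (≈-sym dZ)) eZ))
  equivariant-step (σ-and P) f S ea ex eZ with inv-and eZ
  ... | Ys , refl , ps , qs with S
  ... | s-and P' = and≈ (equivariantF f ea ex P ps P') (equivariantB f ea ex P qs P')
  equivariant-step (σ-neg D) f S ea ex eZ with inv-neg eZ
  ... | Y , refl , d with S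
  ... | s-neg D' = neg≈ (subst-equivariant D f D' ea ex d)
  equivariant-step (σ-all n fr D) f S ea ex eZ with inv-all eZ
  ... | c , X₀ , refl , ab with S
  ... | s-all n' fr' D' = abs-all (abs-equivariant f n fr ea ex n' fr' (fa-subst' D) ab
                                    (λ f' → subst-equivariant D f' D'))
  equivariant-step (σ-st n fr D) f S ea ex eZ with inv-st eZ
  ... | c , X₀ , refl , ab with S
  ... | s-st n' fr' D' = abs-st (abs-equivariant f n fr ea ex n' fr' (fa-subst' D) ab
                                  (λ f' → subst-equivariant D f' D'))
  equivariant-step (σ-elt-atm lv D) f S ea ex eZ with inv-elt eZ | inv-atm ex
  ... | y₀ , refl , d | refl with S
  ... | s-elt-atm lv' D' = elt≈ (subst-equivariant D f D' ea ex d)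
  ... | s-elt n' D' = ⊥-elim (n' ea)
  equivariant-step (σ-elt-st lv fr D₁ D₂) f S ea ex eZ with inv-elt eZ | inv-st ex
  ... | y₀ , refl , d | c , X₀ , refl , ab with S
  ... | s-elt n' D' = ⊥-elim (n' ea)
  ... | s-elt-st lv' fr' D₁' D₂' = elt-st-equivariant f fr D₁ D₂ fr' D₁' D₂' ab (subst-equivariant D₁ f D₁' ea ex d)
                                     (λ f' → subst-equivariant D₂ f' D₂')
  equivariant-step (σ-elt n D) f S ea ex eZ with inv-elt eZ
  ... | y₀ , refl , d with S
  ... | s-elt-atm lv' D' = ⊥-elim (n (sym (inj f ea)))
  ... | s-elt-st lv' fr' D₁' D₂' = ⊥-elim (n (sym (inj f ea)))
  ... | s-elt n' D' = elt≈ (subst-equivariant D f D' ea ex d)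
  equivariant-step σ-atm f S ea ex eZ with inv-atm eZ
  ... | refl with S
  ... | s-atm = ex
  ... | s-atm' n' = ⊥-elim (n' ea)
  equivariant-step (σ-atm' n) f S ea ex eZ with inv-atm eZ
  ... | refl with S
  ... | s-atm = ⊥-elim (n (sym (inj f ea)))
  ... | s-atm' n' = atm≈

  equivariantF : ∀ {a x a' x₀} (f : Ren) → fn f a ≡ a' → ren (fn f) x ≈α x₀ → ∀ {Xs Rs Ys Rs'} →
       Pointwise (Subst a x) Xs Rs → All (λ X → Any (X ≈α_) Ys) (renL (fn f) Xs) →
       Pointwise (Subst a' x₀) Ys Rs' → All (λ R → Any (R ≈α_) Rs') (renL (fn f) Rs)
  equivariantF f ea ex [] [] P' = []
  equivariantF f ea ex (D ∷ P) (p ∷ ps) P' = equivariantF₁ f ea ex D p P' ∷ equivariantF f ea ex P ps P'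

  equivariantF₁ : ∀ {a x a' x₀} (f : Ren) → fn f a ≡ a' → ren (fn f) x ≈α x₀ → ∀ {X R Ys Rs'} →
       Subst a x X R → Any (ren (fn f) X ≈α_) Ys →
       Pointwise (Subst a' x₀) Ys Rs' → Any (ren (fn f) R ≈α_) Rs'
  equivariantF₁ f ea ex D (here e)  (D' ∷ P') = here (subst-equivariant D f D' ea ex e)
  equivariantF₁ f ea ex D (there p) (D' ∷ P') = there (equivariantF₁ f ea ex D p P')

  equivariantB : ∀ {a x a' x₀} (f : Ren) → fn f a ≡ a' → ren (fn f) x ≈α x₀ → ∀ {Xs Rs Ys Rs'} →
       Pointwise (Subst a x) Xs Rs → All (λ Y → Any (_≈α Y) (renL (fn f) Xs)) Ys →
       Pointwise (Subst a' x₀) Ys Rs' → All (λ R' → Any (_≈α R') (renL (fn f) Rs)) Rs'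
  equivariantB f ea ex P [] [] = []
  equivariantB f ea ex P (q ∷ qs) (D' ∷ P') = equivariantB₁ f ea ex P q D' ∷ equivariantB f ea ex P qs P'

  equivariantB₁ : ∀ {a x a' x₀} (f : Ren) → fn f a ≡ a' → ren (fn f) x ≈α x₀ → ∀ {Xs Rs Y R'} →
       Pointwise (Subst a x) Xs Rs → Any (_≈α Y) (renL (fn f) Xs) →
       Subst a' x₀ Y R' → Any (_≈α R') (renL (fn f) Rs)
  equivariantB₁ f ea ex (D ∷ P) (here e)  D' = here (subst-equivariant D f D' ea ex e)
  equivariantB₁ f ea ex (D ∷ P) (there q) D' = there (equivariantB₁ f ea ex P q D')

subst-unique : ∀ {a x Z R R'} → Subst a x Z R → Subst a x Z R' → R' ≈α R
subst-unique {x = x} {Z} {R} D D' =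
  ≈-sym (subst (_≈α _) (ren-id R) (subst-equivariant D idR D' refl (≈-reflexive (ren-id x)) (≈-reflexive (ren-id Z))))

mutual
  ren-pred : (f : Ren) → ∀ {X} → IsPred X → IsPred (ren (fn f) X)
  ren-pred f (and-P ps) = and-P (ren-preds f ps)
  ren-pred f (neg-P p) = neg-P (ren-pred f p)
  ren-pred f (all-P p) = all-P (ren-pred f p)
  ren-pred f (elt-P {a = a} lv t) = elt-P (trans (lev f a) lv) (ren-set f t)

  ren-preds : (f : Ren) → ∀ {Xs} → All IsPred Xs → All IsPred (renL (fn f) Xs)
  ren-preds f []       = []
  ren-preds f (p ∷ ps) = ren-pred f p ∷ ren-preds f ps

  ren-set : (f : Ren) → ∀ {k X} → IsSet k X → IsSet k (ren (fn f) X)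
  ren-set f (atm-S {a = a} lv) = atm-S (trans (lev f a) lv)
  ren-set f (st-S {a = a} lv p) = st-S (trans (lev f a) lv) (ren-pred f p)

-- Fuel arithmetic: the fuel n bounds level(a) - L, where L is the level
-- bound to be preserved.
level-pred : ∀ {i j} → i ≡ j + 1ℤ → i - 1ℤ ≡ j
level-pred {j = j} refl = cancel j
  where
  cancel : ∀ j → j + 1ℤ - 1ℤ ≡ j
  cancel = solve-∀

fuel-step : ∀ ℓ L n → ℓ ≤ L + + suc n → ℓ - 1ℤ ≤ L + + n
fuel-step ℓ L n p = subst (ℓ - 1ℤ ≤_) (cancel L (+ n)) (ℤP.+-monoˡ-≤ (- 1ℤ) p)
  where
  cancel : ∀ L m → L + (1ℤ + m) - 1ℤ ≡ L + m
  cancel = solve-∀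

fuel-empty : ∀ ℓ L → ℓ ≤ L + + 0 → L ≤ ℓ - 1ℤ → ⊥
fuel-empty ℓ L p q = ℤP.<⇒≱ ℓ-1<ℓ (ℤP.≤-trans (subst (ℓ ≤_) (ℤP.+-identityʳ L) p) q)
  where
  ℓ-1<ℓ : ℓ - 1ℤ < ℓ
  ℓ-1<ℓ = ℤP.i≤pred[j]⇒i<j (ℤP.≤-reflexive (ℤP.+-comm ℓ (- 1ℤ)))

fuel-enough : ∀ ℓ L → L ≤ ℓ → ℓ ≤ L + + ∣ ℓ - L ∣
fuel-enough ℓ L p =
  ℤP.≤-reflexive (trans (sym (cancel ℓ L)) (cong (λ m → L + m) (sym (ℤP.0≤i⇒+∣i∣≡i (ℤP.i≤j⇒0≤j-i p)))))
  where
  cancel : ∀ ℓ L → L + (ℓ - L) ≡ ℓ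
  cancel = solve-∀

record Bounds (n : ℕ) (L : ℤ) (a : Atom) (i : ℤ) (x : Term) : Set where
  field
    level-a : level a ≡ i
    L≤a     : L ≤ level a
    L≤x     : L ≤ minlev x
    fuel    : level a ≤ L + + n
open Bounds

PredResult : Atom → Term → Term → ℤ → Set
PredResult a x Z L = Σ Term λ R → Subst a x Z R × L ≤ minlev R × IsPred R

SetResult : Atom → Term → Term → ℤ → ℤ → Set
SetResult a x Z L k = Σ Term λ R → Subst a x Z R × L ≤ minlev R × IsSet k R

fresh-binder : ∀ {a x} (g : Ren) (c : Atom) (X : Term) (P : Term → Set) →
  ((g' : Ren) → P (ren (fn g') X)) →
  Σ Atom λ b' → Σ Term λ Y → AbsR (fn g c) (ren (fn g) X) b' Y ×
    level b' ≡ level c × b' ≢ a × b' # x × P Y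
fresh-binder {a} {x} g c X P P-all with fresh (level c) (and (atm a ∷ x ∷ ren (fn g) X ∷ atm (fn g c) ∷ []))
... | b' , lvb' , fr = b' , ren (fn g') X , inj₂ (gc≢b' , sym lv' , b'#gX , ≈-reflexive (swap-ren b' (fn g c) (fn g) X)) ,
                       lvb' , b'≢a , b'#x , P-all g'
  where
  b'≢a : b' ≢ a
  b'≢a refl = fr (fa-and (here fa-atm))
  b'#x : b' # x
  b'#x q = fr (fa-and (there (here q)))
  b'#gX : b' # ren (fn g) X
  b'#gX q = fr (fa-and (there (there (here q))))
  gc≢b' : fn g c ≢ b'
  gc≢b' refl = fr (fa-and (there (there (there (here fa-atm)))))
  lv' : level b' ≡ level (fn g c)
  lv' = trans lvb' (sym (lev g c))
  g' : Ren
  g' = swapR b' (fn g c) lv' ∘R g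

st-rebind : ∀ a₁ X₁ T → Σ Atom λ a₂ → level a₂ ≡ level a₁ × a₂ # T ×
            st a₁ X₁ ≈α st a₂ (ren (swapAtom a₂ a₁) X₁)
st-rebind a₁ X₁ T with fresh (level a₁) (and (atm a₁ ∷ T ∷ X₁ ∷ []))
... | a₂ , lv , fr = a₂ , lv , (λ q → fr (fa-and (there (here q)))) ,
  st≈' a₁≢a₂ (sym lv) (λ q → fr (fa-and (there (there (here q))))) (≈-reflexive (swap-is-ren a₂ a₁ X₁))
  where
  a₁≢a₂ : a₁ ≢ a₂
  a₁≢a₂ refl = fr (fa-and (here fa-atm))

mutual
  exists-pred : ∀ n {L a i x} → Bounds n L a i x → IsSet i x → (g : Ren) → ∀ {Z} → IsPred Z → L ≤ minlev Z →
                PredResult a x (ren (fn g) Z) L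
  exists-pred n b tx g (and-P ts) p with exists-preds n b tx g ts p
  ... | Rs , P , m , tRs = and Rs , σ-and P , m , and-P tRs
  exists-pred n b tx g (neg-P t) p with exists-pred n b tx g t p
  ... | R , D , m , tR = neg R , σ-neg D , m , neg-P tR
  exists-pred n {L} {a} {i} {x} b tx g (all-P {a = c} {X = X} t) p
    with fresh-binder {a} {x} g c X (λ Y → PredResult a x Y L) (λ g' → exists-pred n b tx g' t (ℤP.i≤j⊓k⇒i≤k _ _ p))
  ... | c' , Y , ab , lvc' , c'≢a , c'#x , (R , D , m , tR) =
        all c' R , σ-α (≈-refl x) (abs-all ab) (≈-refl _) (σ-all c'≢a c'#x D) ,
        ℤP.⊓-glb (subst (L ≤_) (sym lvc') (ℤP.i≤j⊓k⇒i≤j _ _ p)) m , all-P tR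
  exists-pred n {L} {a} b tx g (elt-P {a = d} lv ty) p with fn g d ≟ₐ a
  ... | no ne with exists-set n b tx g ty (ℤP.i≤j⊓k⇒i≤j _ _ p)
  ...   | R , D , m , tR = elt R (fn g d) , σ-elt ne D ,
                           ℤP.⊓-glb m (subst (L ≤_) (sym (lev g d)) (ℤP.i≤j⊓k⇒i≤k _ _ p)) , elt-P (trans (lev g d) lv) tR
  exists-pred n {L} {a} b tx@(atm-S {a = m} lvm) g (elt-P {a = d} lv ty) p | yes refl
    with exists-set n b tx g ty (ℤP.i≤j⊓k⇒i≤j _ _ p)
  ... | R , D , mR , tR = elt R m , σ-elt-atm (trans lvm (sym (level-a b))) D , ℤP.⊓-glb mR (L≤x b) ,
                          elt-P (trans lvm (trans (sym (level-a b)) (trans (lev g d) lv))) tR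
  exists-pred zero {L} {a} b (st-S {a = a₁} lv₁ _) g (elt-P lv ty) p | yes refl =
    ⊥-elim (fuel-empty (level a) L (fuel b)
      (subst (L ≤_) (trans lv₁ (cong (_- 1ℤ) (sym (level-a b)))) (ℤP.i≤j⊓k⇒i≤j _ _ (L≤x b))))
  exists-pred (suc n) b tx@(st-S _ _) g (elt-P {a = d} lv ty) p | yes refl
    with exists-set (suc n) b tx g ty (ℤP.i≤j⊓k⇒i≤j _ _ p)
  ... | y₁ , D₁ , my₁ , ty₁ = exists-elt-st n b tx (trans (sym (level-a b)) (trans (lev g d) lv)) D₁ my₁ ty₁

  -- The clause elt(y, a)[a ↦ st([a₁]X₁)] = X₁[a₁ ↦ y₁], given y[a ↦ st([a₁]X₁)] = y₁:
  -- the binder a₁ is first renamed to a₂ fresh for y, and the outer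
  -- substitution is at the level of a₂, one below a, with one less fuel.
  exists-elt-st : ∀ n {L a i a₁ X₁} → Bounds (suc n) L a i (st a₁ X₁) → IsSet i (st a₁ X₁) → ∀ {j y y₁} →
                  i ≡ j + 1ℤ → Subst a (st a₁ X₁) y y₁ → L ≤ minlev y₁ → IsSet j y₁ →
                  PredResult a (st a₁ X₁) (elt y a) L
  exists-elt-st n {L} {a} {i} {a₁} {X₁} b (st-S lv₁ tX₁) {j} {y} {y₁} i≡j+1 D₁ my₁ ty₁ with st-rebind a₁ X₁ y
  ... | a₂ , lv₂₁ , a₂#y , rebind =
    let (R , D₂ , mR , tR) = exists-pred n b' ty₁ (swapR a₂ a₁ lv₂₁) tX₁ (ℤP.i≤j⊓k⇒i≤k _ _ (L≤x b))
        D₁' = σ-α (≈-sym rebind) (≈-refl _) (≈-refl _) D₁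
    in R , σ-α rebind (≈-refl _) (≈-refl _) (σ-elt-st a₂-below-a a₂#y D₁' D₂) , mR , tR
    where
    a₂-below-a : level a₂ ≡ level a - 1ℤ
    a₂-below-a = trans lv₂₁ (trans lv₁ (cong (_- 1ℤ) (sym (level-a b))))
    b' : Bounds n L a₂ j y₁
    b' = record { level-a = trans a₂-below-a (trans (cong (_- 1ℤ) (level-a b)) (level-pred i≡j+1))
                ; L≤a     = subst (L ≤_) (sym lv₂₁) (ℤP.i≤j⊓k⇒i≤j _ _ (L≤x b))
                ; L≤x     = my₁
                ; fuel    = subst (_≤ L + + n) (sym a₂-below-a) (fuel-step (level a) L n (fuel b)) }

  exists-set : ∀ n {L a i x} → Bounds n L a i x → IsSet i x → (g : Ren) → ∀ {k Z} → IsSet k Z → L ≤ minlev Z →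
               SetResult a x (ren (fn g) Z) L k
  exists-set n {L} {a} {i} {x} b tx g (atm-S {a = d} lv) p with fn g d ≟ₐ a
  ... | yes refl = x , σ-atm , L≤x b , subst (λ k → IsSet k x) (trans (sym (level-a b)) (trans (lev g d) lv)) tx
  ... | no ne = atm (fn g d) , σ-atm' ne , subst (L ≤_) (sym (lev g d)) p , atm-S (trans (lev g d) lv)
  exists-set n {L} {a} {i} {x} b tx g (st-S {a = c} {X = X} lv t) p
    with fresh-binder {a} {x} g c X (λ Y → PredResult a x Y L) (λ g' → exists-pred n b tx g' t (ℤP.i≤j⊓k⇒i≤k _ _ p))
  ... | c' , Y , ab , lvc' , c'≢a , c'#x , (R , D , m , tR) =
        st c' R , σ-α (≈-refl x) (abs-st ab) (≈-refl _) (σ-st c'≢a c'#x D) ,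
        ℤP.⊓-glb (subst (L ≤_) (sym lvc') (ℤP.i≤j⊓k⇒i≤j _ _ p)) m , st-S (trans lvc' lv) tR

  exists-preds : ∀ n {L a i x} → Bounds n L a i x → IsSet i x → (g : Ren) → ∀ {Xs} → All IsPred Xs → L ≤ minlevs Xs →
                 Σ (List Term) λ Rs → Pointwise (Subst a x) (renL (fn g) Xs) Rs × L ≤ minlevs Rs × All IsPred Rs
  exists-preds n b tx g [] p = [] , [] , p , []
  exists-preds n b tx g (t ∷ ts) p
    with exists-pred n b tx g t (ℤP.i≤j⊓k⇒i≤j _ _ p) | exists-preds n b tx g ts (ℤP.i≤j⊓k⇒i≤k _ _ p)
  ... | R , D , m , tR | Rs , P , ms , tRs = R ∷ Rs , D ∷ P , ℤP.⊓-glb m ms , tR ∷ tRs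

initial-bounds : ∀ {a i x} Z → level a ≡ i → Bounds ∣ level a - minlev₃ Z a x ∣ (minlev₃ Z a x) a i x
initial-bounds {a} {i} {x} Z lva = record
  { level-a = lva
  ; L≤a     = L≤a'
  ; L≤x     = ℤP.i≤j⊓k⇒i≤k _ _ L≤a⊓x
  ; fuel    = fuel-enough (level a) (minlev₃ Z a x) L≤a' }
  where
  L≤a⊓x : minlev₃ Z a x ≤ level a ⊓ minlev x
  L≤a⊓x = ℤP.i⊓j≤j (minlev Z) (level a ⊓ minlev x)
  L≤a' : minlev₃ Z a x ≤ level a
  L≤a' = ℤP.i≤j⊓k⇒i≤j _ _ L≤a⊓x

subst-exists-pred : ∀ {i a x Z} → level a ≡ i → IsSet i x → IsPred Z → PredResult a x Z (minlev₃ Z a x)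
subst-exists-pred {a = a} {x} {Z} lva tx tZ =
  subst (λ Z' → PredResult a x Z' (minlev₃ Z a x)) (ren-id Z)
        (exists-pred _ (initial-bounds Z lva) tx idR tZ (ℤP.i⊓j≤i _ _))

subst-exists-set : ∀ {i a x k z} → level a ≡ i → IsSet i x → IsSet k z → SetResult a x z (minlev₃ z a x) k
subst-exists-set {a = a} {x} {k} {z} lva tx tz =
  subst (λ z' → SetResult a x z' (minlev₃ z a x) k) (ren-id z)
        (exists-set _ (initial-bounds z lva) tx idR tz (ℤP.i⊓j≤i _ _))

proposition4p6 : (i : ℤ) (a : Atom) (x : Term) → level a ≡ i → IsSet i x →
    ((Z : Term) → IsPred Z →
      Σ Term (λ R → Subst a x Z R × ((R' : Term) → Subst a x Z R' → R' ≈α R)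
        × minlev₃ Z a x ≤ minlev R × IsPred R))
    × ((k : ℤ) (z : Term) → IsSet k z →
      Σ Term (λ R → Subst a x z R × ((R' : Term) → Subst a x z R' → R' ≈α R)
        × minlev₃ z a x ≤ minlev R × IsSet k R))
proposition4p6 i a x lva tx = pred-case , set-case
  where
  pred-case : (Z : Term) → IsPred Z → Σ Term (λ R → Subst a x Z R × ((R' : Term) → Subst a x Z R' → R' ≈α R)
                × minlev₃ Z a x ≤ minlev R × IsPred R)
  pred-case Z tZ with subst-exists-pred lva tx tZ
  ... | R , D , m , tR = R , D , (λ _ → subst-unique D) , m , tR

  set-case : (k : ℤ) (z : Term) → IsSet k z → Σ Term (λ R → Subst a x z R × ((R' : Term) → Subst a x z R' → R' ≈α R)
               × minlev₃ z a x ≤ minlev R × IsSet k R)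
  set-case k z tz with subst-exists-set lva tx tz
  ... | R , D , m , tR = R , D , (λ _ → subst-unique D) , m , tR
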